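{- Let $1\leqslant k<n$ be integers. If $x=(x_1,\ldots,x_n)^\top$ is a positive real root of $\mathsf{J}_{k,n}$ with $\deg(x)=d\geqslant 1$, then $0\leqslant x_i\leqslant d$ for all $i=1,\ldots,n$.
   Context: Let $\mathbb{Z}\Delta=\{x\in\mathbb{Z}^n: k\mid x_1+\cdots+x_n\}$ with basis of simple roots $\alpha_i=e_{i+1}-e_i$ ($1\leqslant i\leqslant n-1$) and $\beta=e_1+\cdots+e_k$. The degree of $x$ is the coefficient of $\beta$ in $x$, equal to $(x_1+\cdots+x_n)/k$. The Weyl group $W(\mathsf{J}_{k,n})$ is generated by $s_i$ ($i=1,\ldots,n-1$, swapping coordinates $i$ and $i+1$) and $s_\beta(x)=(x_1+r,\ldots,x_k+r,x_{k+1},\ldots,x_n)^\top$, $r=x_{k+1}+\cdots+x_n-2\deg(x)$. Real roots are the elements of the orbit $W(\mathsf{J}_{k,n})\beta$; positive means all coefficients in the basis $\beta,\alpha_1,\ldots,\alpha_{n-1}$ are non-negative. -}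

module Defs where

open import Data.Nat as ℕ using (ℕ; zero; suc)
open import Data.Integer using (ℤ; +_; _+_; _-_; _*_; _/_; 0ℤ; 1ℤ)
open import Data.Fin using (Fin; toℕ)
open import Data.Fin.Permutation.Components using (transpose)
open import Data.List using (List; map; upTo)
open import Data.Bool using (if_then_else_)
open import Relation.Nullary.Decidable using (does)
open import Relation.Binary.PropositionalEquality using (_≡_)
import Data.List as L
import Data.Vec.Functional as VF

-- Vectors in ℤ^n are functions Fin n → ℤ; coordinates are 0-indexed
-- (coordinate j : Fin n corresponds to the paper's x_{toℕ j + 1}).
Vec : ℕ → Set
Vec n = Fin n → ℤ

sumAll : ∀ {n} → Vec n → ℤ
sumAll = VF.foldr _+_ 0ℤ

sumFrom : ∀ {n} → ℕ → Vec n → ℤ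
sumFrom {n} k x = VF.foldr _+_ 0ℤ (λ j → if does (k ℕ.≤? toℕ j) then x j else 0ℤ)

-- deg x = (x_1 + ... + x_n) / k   (exact on the lattice ℤΔ; k ≥ 1 is assumed
-- in the theorem, the value for k = 0 is an irrelevant convention)
deg : ∀ {n} → ℕ → Vec n → ℤ
deg zero    x = 0ℤ
deg (suc k) x = sumAll x / (+ suc k)

β : ∀ {n} → ℕ → Vec n
β k j = if does (suc (toℕ j) ℕ.≤? k) then 1ℤ else 0ℤ

-- α i = e_{i+2} - e_{i+1} in the paper's 1-indexed notation, i.e. the paper's
-- α_{i+1}, for i = 0,...,n-2.
α : ∀ {n} → ℕ → Vec n
α i j = (if does (toℕ j ℕ.≟ suc i) then 1ℤ else 0ℤ)
      - (if does (toℕ j ℕ.≟ i) then 1ℤ else 0ℤ)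

combo : ∀ {n} → ℕ → ℤ → (ℕ → ℤ) → Vec n
combo {n} k d c j = d * β k j + L.foldr _+_ 0ℤ (map (λ i → c i * α i j) (upTo (n ℕ.∸ 1)))

IsPositive : ∀ {n} → ℕ → Vec n → Set
IsPositive {n} k x =
  Σ' ℤ (λ d → Σ' (ℕ → ℤ) (λ c →
    ((j : Fin n) → x j ≡ combo k d c j)
    × (0ℤ Data.Integer.≤ d)
    × ((i : ℕ) → i ℕ.< n ℕ.∸ 1 → 0ℤ Data.Integer.≤ c i)))
  where
  open import Data.Product using (_×_) renaming (Σ to Σ')

sSwap : ∀ {n} → Fin n → Fin n → Vec n → Vec n
sSwap i j x l = x (transpose i j l)

sβ : ∀ {n} → ℕ → Vec n → Vec n
sβ k x j = if does (suc (toℕ j) ℕ.≤? k)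
             then x j + (sumFrom k x - (+ 2) * deg k x)
             else x j

-- Real roots: the orbit W(J_{k,n}) β.  Since each generator is an involution,
-- the orbit is the closure of {β} under the generators.
data RealRoot {n : ℕ} (k : ℕ) : Vec n → Set where
  root-β  : RealRoot k (β k)
  root-si : ∀ {x} (i j : Fin n) → toℕ j ≡ suc (toℕ i) →
            RealRoot k x → RealRoot k (sSwap i j x)
  root-sβ : ∀ {x} → RealRoot k x → RealRoot k (sβ k x)

module Submission where

-- Write a real root of J_{k,n} in coordinates with respect to the simple roots β, α_1, ..., α_{n-1}.
-- The generators of the Weyl group then act as the reflections of a simply-laced Cartan matrix, so,
-- exactly as for Kac–Moody root systems, every real root is positive or negative: by induction on
-- the length of a word w one proves simultaneously that w sends each simple root to a positive or
-- negative root, and that if it sends the simple root s to a negative root then w r_s is shorter,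
-- the rank-two cases being the commutation and braid relations.  The transpositions s_i permute the
-- coordinates without changing the degree d, so any coordinate x_i of a root of degree d ≥ 1 (hence
-- positive) can be moved to position n, where it is the coefficient of α_{n-1} and hence ≥ 0, or to
-- position 1, where it equals d minus the coefficient of α_1 and hence is ≤ d.

open import Defs
open import Data.Nat as ℕ using (ℕ; zero; suc; z≤n; s≤s; _≤_; _<_)
import Data.Nat.Properties as ℕ
open import Data.Nat.Induction using (<-wellFounded)
open import Data.Integer as ℤ using (ℤ; +_; -[1+_]; +≤+; _+_; _-_; _*_; -_; 0ℤ; 1ℤ; -1ℤ) renaming (_≤_ to _≤ℤ_)
import Data.Integer.Properties as ℤ
open import Data.Integer.DivMod using (a≡a%n+[a/n]*n; n%d<d)
open import Data.Integer.Tactic.RingSolver using (solve-∀)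
open import Data.List using (List; []; _∷_; _∷ʳ_; length)
open import Data.Product using (Σ-syntax; _×_; _,_; proj₁; proj₂)
open import Data.Sum as Sum using (_⊎_; inj₁; inj₂)
open import Data.Bool using (Bool; true; false; if_then_else_)
open import Data.Empty using (⊥-elim)
open import Function using (_on_; _∘_; case_of_)
open import Induction.WellFounded as WF using (WfRec)
import Relation.Binary.Construct.On as On
open import Relation.Binary.Definitions using (DecidableEquality)
open import Relation.Binary.PropositionalEquality
open import Relation.Nullary using (¬_; Dec; yes; no; does)
open import Relation.Nullary.Decidable using (dec-true; dec-false)
open import Data.Fin as Fin using (Fin; zero; suc; toℕ; inject₁; fromℕ)
import Data.Fin.Properties as Fin
open import Data.Fin.Induction using (<-weakInduction; >-weakInduction)
open import Data.Fin.Permutation.Components using (transpose)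
open import Algebra.Properties.Semiring.Sum ℤ.+-*-semiring
  using (sum-syntax; ∑-comm; sum-cong-≗; sum-replicate-zero; *-distribˡ-sum)

module RootSystem {I : Set} (_≟_ : DecidableEquality I) where

  Coeffs : Set
  Coeffs = I → ℤ

  e : I → Coeffs
  e s t = if does (s ≟ t) then 1ℤ else 0ℤ

  e-diagonal : ∀ s → e s s ≡ 1ℤ
  e-diagonal s rewrite dec-true (s ≟ s) refl = refl

  _+ᶜ_ : Coeffs → Coeffs → Coeffs
  (c +ᶜ d) t = c t + d t

  -ᶜ_ : Coeffs → Coeffs
  (-ᶜ c) t = - c t

  0ᶜ : Coeffs
  0ᶜ _ = 0ℤ

  NonNeg NonPos Signed : Coeffs → Set
  NonNeg c = ∀ t → 0ℤ ≤ℤ c t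
  NonPos c = ∀ t → c t ≤ℤ 0ℤ
  Signed c = NonNeg c ⊎ NonPos c

  NonNeg-resp : ∀ {c d} → c ≗ d → NonNeg c → NonNeg d
  NonNeg-resp c≗d c≥0 t = subst (0ℤ ≤ℤ_) (c≗d t) (c≥0 t)

  NonPos-resp : ∀ {c d} → c ≗ d → NonPos c → NonPos d
  NonPos-resp c≗d c≤0 t = subst (_≤ℤ 0ℤ) (c≗d t) (c≤0 t)

  Signed-resp : ∀ {c d} → c ≗ d → Signed c → Signed d
  Signed-resp c≗d (inj₁ c≥0) = inj₁ (NonNeg-resp c≗d c≥0)
  Signed-resp c≗d (inj₂ c≤0) = inj₂ (NonPos-resp c≗d c≤0)

  Signed-neg : ∀ {c} → Signed c → Signed (-ᶜ c)
  Signed-neg (inj₁ c≥0) = inj₂ (λ t → ℤ.neg-mono-≤ (c≥0 t))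
  Signed-neg (inj₂ c≤0) = inj₁ (λ t → ℤ.neg-mono-≤ (c≤0 t))

  NonNeg-e : ∀ s → NonNeg (e s)
  NonNeg-e s t with does (s ≟ t)
  ... | true  = +≤+ z≤n
  ... | false = ℤ.≤-refl

  ¬NonPos-e : ∀ s → ¬ NonPos (e s)
  ¬NonPos-e s e≤0 with subst (_≤ℤ 0ℤ) (e-diagonal s) (e≤0 s)
  ... | +≤+ ()

  NonNeg-sum-NonPos⇒≗0ᶜ : ∀ {c d} → NonNeg c → NonNeg d → NonPos (c +ᶜ d) → c ≗ 0ᶜ
  NonNeg-sum-NonPos⇒≗0ᶜ {c} {d} c≥0 d≥0 c+d≤0 t =
    ℤ.≤-antisym (ℤ.≤-trans c≤c+d (c+d≤0 t)) (c≥0 t)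
    where
    c≤c+d : c t ≤ℤ c t + d t
    c≤c+d = subst (_≤ℤ c t + d t) (ℤ.+-identityʳ (c t)) (ℤ.+-monoʳ-≤ (c t) (d≥0 t))

  module SimplyLaced
    (⟨_,_⟩ : Coeffs → I → ℤ)
    (⟨⟩-cong : ∀ {c d} → c ≗ d → ∀ s → ⟨ c , s ⟩ ≡ ⟨ d , s ⟩)
    (⟨⟩-linear : ∀ c d a s → ⟨ (λ t → c t - a * d t) , s ⟩ ≡ ⟨ c , s ⟩ - a * ⟨ d , s ⟩)
    (⟨⟩-diagonal : ∀ s → ⟨ e s , s ⟩ ≡ + 2)
    (⟨⟩-symmetric : ∀ s t → ⟨ e s , t ⟩ ≡ ⟨ e t , s ⟩)
    (⟨⟩-offDiagonal : ∀ s t → s ≢ t → ⟨ e s , t ⟩ ≡ -1ℤ ⊎ ⟨ e s , t ⟩ ≡ 0ℤ)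
    where

    ⟨⟩-+ : ∀ c d s → ⟨ c +ᶜ d , s ⟩ ≡ ⟨ c , s ⟩ + ⟨ d , s ⟩
    ⟨⟩-+ c d s = begin
      ⟨ c +ᶜ d , s ⟩                      ≡⟨ ⟨⟩-cong (λ t → x+y≡x-[-1]y (c t) (d t)) s ⟩
      ⟨ (λ t → c t - -1ℤ * d t) , s ⟩     ≡⟨ ⟨⟩-linear c d -1ℤ s ⟩
      ⟨ c , s ⟩ - -1ℤ * ⟨ d , s ⟩         ≡⟨ sym (x+y≡x-[-1]y ⟨ c , s ⟩ ⟨ d , s ⟩) ⟩
      ⟨ c , s ⟩ + ⟨ d , s ⟩               ∎
      where
      open ≡-Reasoning
      x+y≡x-[-1]y : ∀ x y → x + y ≡ x - -1ℤ * y
      x+y≡x-[-1]y = solve-∀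

    ⟨⟩-neg : ∀ c s → ⟨ -ᶜ c , s ⟩ ≡ - ⟨ c , s ⟩
    ⟨⟩-neg c s = begin
      ⟨ -ᶜ c , s ⟩                        ≡⟨ ⟨⟩-cong (λ t → -x≡x-2x (c t)) s ⟩
      ⟨ (λ t → c t - + 2 * c t) , s ⟩     ≡⟨ ⟨⟩-linear c c (+ 2) s ⟩
      ⟨ c , s ⟩ - + 2 * ⟨ c , s ⟩         ≡⟨ sym (-x≡x-2x ⟨ c , s ⟩) ⟩
      - ⟨ c , s ⟩                         ∎
      where
      open ≡-Reasoning
      -x≡x-2x : ∀ x → - x ≡ x - + 2 * x
      -x≡x-2x = solve-∀

    reflect : I → Coeffs → Coeffs
    reflect s c t = c t - ⟨ c , s ⟩ * e s t

    ⟨reflect⟩ : ∀ s c t → ⟨ reflect s c , t ⟩ ≡ ⟨ c , t ⟩ - ⟨ c , s ⟩ * ⟨ e s , t ⟩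
    ⟨reflect⟩ s c = ⟨⟩-linear c (e s) ⟨ c , s ⟩

    reflect-cong : ∀ s {c d} → c ≗ d → reflect s c ≗ reflect s d
    reflect-cong s c≗d t = cong₂ (λ x p → x - p * e s t) (c≗d t) (⟨⟩-cong c≗d s)

    reflect-+ : ∀ s c d → reflect s (c +ᶜ d) ≗ reflect s c +ᶜ reflect s d
    reflect-+ s c d t rewrite ⟨⟩-+ c d s = identity (c t) (d t) ⟨ c , s ⟩ ⟨ d , s ⟩ (e s t)
      where
      identity : ∀ x y p q u → x + y - (p + q) * u ≡ (x - p * u) + (y - q * u)
      identity = solve-∀

    reflect-neg : ∀ s c → reflect s (-ᶜ c) ≗ -ᶜ reflect s c
    reflect-neg s c t rewrite ⟨⟩-neg c s = identity (c t) ⟨ c , s ⟩ (e s t)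
      where
      identity : ∀ x p u → - x - - p * u ≡ - (x - p * u)
      identity = solve-∀

    reflect-involutive : ∀ s c → reflect s (reflect s c) ≗ c
    reflect-involutive s c t rewrite ⟨reflect⟩ s c s | ⟨⟩-diagonal s =
      identity (c t) ⟨ c , s ⟩ (e s t)
      where
      identity : ∀ x p u → x - p * u - (p - p * + 2) * u ≡ x
      identity = solve-∀

    ⟨⟩-0ᶜ : ∀ s → ⟨ 0ᶜ , s ⟩ ≡ 0ℤ
    ⟨⟩-0ᶜ s = trans (⟨⟩-linear 0ᶜ 0ᶜ 1ℤ s) (x-1x≡0 ⟨ 0ᶜ , s ⟩)
      where
      x-1x≡0 : ∀ x → x - 1ℤ * x ≡ 0ℤ
      x-1x≡0 = solve-∀

    reflect-0ᶜ : ∀ s → reflect s 0ᶜ ≗ 0ᶜ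
    reflect-0ᶜ s t rewrite ⟨⟩-0ᶜ s = refl

    act : List I → Coeffs → Coeffs
    act []      c = c
    act (s ∷ w) c = act w (reflect s c)

    act-∷ʳ : ∀ w s c → act (w ∷ʳ s) c ≡ reflect s (act w c)
    act-∷ʳ []      s c = refl
    act-∷ʳ (t ∷ w) s c = act-∷ʳ w s (reflect t c)

    act-cong : ∀ w {c d} → c ≗ d → act w c ≗ act w d
    act-cong []      c≗d = c≗d
    act-cong (s ∷ w) c≗d = act-cong w (reflect-cong s c≗d)

    act-+ : ∀ w c d → act w (c +ᶜ d) ≗ act w c +ᶜ act w d
    act-+ []      c d t = refl
    act-+ (s ∷ w) c d t =
      trans (act-cong w (reflect-+ s c d) t) (act-+ w (reflect s c) (reflect s d) t)

    act-neg : ∀ w c → act w (-ᶜ c) ≗ -ᶜ act w c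
    act-neg []      c t = refl
    act-neg (s ∷ w) c t = trans (act-cong w (reflect-neg s c) t) (act-neg w (reflect s c) t)

    act-≗0ᶜ : ∀ w c → act w c ≗ 0ᶜ → c ≗ 0ᶜ
    act-≗0ᶜ []      c c≗0 = c≗0
    act-≗0ᶜ (s ∷ w) c wc≗0 t = begin
      c t                           ≡⟨ sym (reflect-involutive s c t) ⟩
      reflect s (reflect s c) t     ≡⟨ reflect-cong s (act-≗0ᶜ w (reflect s c) wc≗0) t ⟩
      reflect s 0ᶜ t                ≡⟨ reflect-0ᶜ s t ⟩
      0ℤ                            ∎
      where open ≡-Reasoning

    reflect-e-self : ∀ s → reflect s (e s) ≗ -ᶜ e s
    reflect-e-self s t rewrite ⟨⟩-diagonal s = identity (e s t)
      where
      identity : ∀ u → u - + 2 * u ≡ - u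
      identity = solve-∀

    reflect-e-orthogonal : ∀ {s t} → ⟨ e s , t ⟩ ≡ 0ℤ → reflect t (e s) ≗ e s
    reflect-e-orthogonal {s} {t} orth u rewrite orth = identity (e s u) (e t u)
      where
      identity : ∀ x y → x - 0ℤ * y ≡ x
      identity = solve-∀

    reflect-e-linked : ∀ {s t} → ⟨ e s , t ⟩ ≡ -1ℤ → reflect t (e s) ≗ e s +ᶜ e t
    reflect-e-linked {s} {t} link u rewrite link = identity (e s u) (e t u)
      where
      identity : ∀ x y → x - -1ℤ * y ≡ x + y
      identity = solve-∀

    reflect-e+e-linked : ∀ {s t} → ⟨ e s , t ⟩ ≡ -1ℤ → reflect t (e s +ᶜ e t) ≗ e s
    reflect-e+e-linked {s} {t} link u
      rewrite ⟨⟩-+ (e s) (e t) t | link | ⟨⟩-diagonal t = identity (e s u) (e t u)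
      where
      identity : ∀ x y → x + y - (-1ℤ + + 2) * y ≡ x
      identity = solve-∀

    reflect-comm : ∀ {s t} → ⟨ e s , t ⟩ ≡ 0ℤ → ⟨ e t , s ⟩ ≡ 0ℤ →
                   ∀ c → reflect s (reflect t c) ≗ reflect t (reflect s c)
    reflect-comm {s} {t} st ts c u rewrite ⟨reflect⟩ t c s | ⟨reflect⟩ s c t | st | ts =
      identity (c u) ⟨ c , s ⟩ ⟨ c , t ⟩ (e s u) (e t u)
      where
      identity : ∀ x a b y z → x - b * z - (a - b * 0ℤ) * y ≡ x - a * y - (b - a * 0ℤ) * z
      identity = solve-∀

    reflect-braid : ∀ {s t} → ⟨ e s , t ⟩ ≡ -1ℤ → ⟨ e t , s ⟩ ≡ -1ℤ →
                    ∀ c → reflect s (reflect t (reflect s c)) ≗ reflect t (reflect s (reflect t c))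
    reflect-braid {s} {t} st ts c u
      rewrite ⟨reflect⟩ t (reflect s c) s | ⟨reflect⟩ s (reflect t c) t
            | ⟨reflect⟩ s c s | ⟨reflect⟩ s c t | ⟨reflect⟩ t c t | ⟨reflect⟩ t c s
            | st | ts | ⟨⟩-diagonal s | ⟨⟩-diagonal t =
      identity (c u) ⟨ c , s ⟩ ⟨ c , t ⟩ (e s u) (e t u)
      where
      identity : ∀ x a b y z →
        x - a * y - (b - a * -1ℤ) * z - (a - a * + 2 - (b - a * -1ℤ) * -1ℤ) * y
        ≡ x - b * z - (a - b * -1ℤ) * y - (b - b * + 2 - (a - b * -1ℤ) * -1ℤ) * z
      identity = solve-∀

    ⟨e⟩-flip : ∀ {s t a} → ⟨ e s , t ⟩ ≡ a → ⟨ e t , s ⟩ ≡ a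
    ⟨e⟩-flip {s} {t} = trans (sym (⟨⟩-symmetric s t))

    act-e-≢0ᶜ : ∀ w s → ¬ (act w (e s) ≗ 0ᶜ)
    act-e-≢0ᶜ w s we≗0 with trans (sym (e-diagonal s)) (act-≗0ᶜ w (e s) we≗0 s)
    ... | ()

    Signs : List I → Set
    Signs w = ∀ s → Signed (act w (e s))

    Descent : List I → Set
    Descent w = ∀ s → NonPos (act w (e s)) →
      Σ[ u ∈ List I ] length u < length w × (∀ c → act w c ≗ act u (reflect s c))

    signs-[] : Signs []
    signs-[] s = inj₁ (NonNeg-e s)

    descent-[] : Descent []
    descent-[] s e≤0 = ⊥-elim (¬NonPos-e s e≤0)

    module Step (t : I) (w : List I)
                (ih : ∀ u → length u ≤ length w → Signs u × Descent u) where

      signs : Signs w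
      signs = proj₁ (ih w ℕ.≤-refl)

      descent : Descent w
      descent = proj₂ (ih w ℕ.≤-refl)

      signs-< : ∀ u → length u < length w → Signs u
      signs-< u u<w = proj₁ (ih u (ℕ.<⇒≤ u<w))

      descent-< : ∀ u → length u < length w → Descent u
      descent-< u u<w = proj₂ (ih u (ℕ.<⇒≤ u<w))

      shortcut : NonPos (act w (e t)) →
                 Σ[ u ∈ List I ] length u < length w × (∀ c → act (t ∷ w) c ≗ act u c)
      shortcut wt≤0 with descent t wt≤0
      ... | u , u<w , w≗ut =
        u , u<w , λ c x → trans (w≗ut (reflect t c) x) (act-cong u (reflect-involutive t c) x)

      act-e-linked : ∀ {s} → ⟨ e s , t ⟩ ≡ -1ℤ → act (t ∷ w) (e s) ≗ act w (e s) +ᶜ act w (e t)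
      act-e-linked {s} link x = trans (act-cong w (reflect-e-linked link) x) (act-+ w (e s) (e t) x)

      act-e-linked-descent : ∀ {s} → ⟨ e s , t ⟩ ≡ -1ℤ → ∀ u → (∀ c → act w c ≗ act u (reflect s c)) →
                             act (t ∷ w) (e s) ≗ act u (e t)
      act-e-linked-descent {s} link u w≗us x = begin
        act w (reflect t (e s)) x                  ≡⟨ w≗us (reflect t (e s)) x ⟩
        act u (reflect s (reflect t (e s))) x      ≡⟨ act-cong u (reflect-cong s (reflect-e-linked link)) x ⟩
        act u (reflect s (e s +ᶜ e t)) x           ≡⟨ act-cong u (reflect-cong s (λ y → ℤ.+-comm (e s y) (e t y))) x ⟩
        act u (reflect s (e t +ᶜ e s)) x           ≡⟨ act-cong u (reflect-e+e-linked (⟨e⟩-flip link)) x ⟩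
        act u (e t) x                              ∎
        where open ≡-Reasoning

      signs-∷ : Signs (t ∷ w)
      signs-∷ s with signs t
      ... | inj₂ wt≤0 with shortcut wt≤0
      ...   | u , u<w , tw≗u = Signed-resp (λ x → sym (tw≗u (e s) x)) (signs-< u u<w s)
      signs-∷ s | inj₁ wt≥0 with s ≟ t
      ... | yes refl = Signed-resp (λ x → sym (trans (act-cong w (reflect-e-self s) x) (act-neg w (e s) x)))
                                   (Signed-neg (signs s))
      ... | no s≢t with ⟨⟩-offDiagonal s t s≢t
      ...   | inj₂ orth = Signed-resp (λ x → sym (act-cong w (reflect-e-orthogonal orth) x)) (signs s)
      ...   | inj₁ link with signs s
      ...     | inj₁ ws≥0 = inj₁ (NonNeg-resp (λ x → sym (act-e-linked link x))
                                              (λ x → ℤ.+-mono-≤ (ws≥0 x) (wt≥0 x)))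
      ...     | inj₂ ws≤0 with descent s ws≤0
      ...       | u , u<w , w≗us = Signed-resp (λ x → sym (act-e-linked-descent link u w≗us x)) (signs-< u u<w t)

      descent-∷ : Descent (t ∷ w)
      descent-∷ s tws≤0 with signs t
      ... | inj₂ wt≤0 with shortcut wt≤0
      ...   | u , u<w , tw≗u with descent-< u u<w s (NonPos-resp (tw≗u (e s)) tws≤0)
      ...     | u′ , u′<u , u≗u′s =
        u′ , ℕ.<-trans u′<u (ℕ.<-trans u<w (ℕ.n<1+n _)) , λ c x → trans (tw≗u c x) (u≗u′s c x)
      descent-∷ s tws≤0 | inj₁ wt≥0 with s ≟ t
      ... | yes refl = w , ℕ.n<1+n _ , λ c x → refl
      ... | no s≢t with ⟨⟩-offDiagonal s t s≢t
      ...   | inj₂ orth with descent s (NonPos-resp (act-cong w (reflect-e-orthogonal orth)) tws≤0)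
      ...     | u , u<w , w≗us = t ∷ u , s≤s u<w , λ c x →
        trans (w≗us (reflect t c) x) (act-cong u (reflect-comm orth (⟨e⟩-flip orth) c) x)
      descent-∷ s tws≤0 | inj₁ wt≥0 | no s≢t | inj₁ link with signs s
      ... | inj₁ ws≥0 = ⊥-elim (act-e-≢0ᶜ w s
                          (NonNeg-sum-NonPos⇒≗0ᶜ ws≥0 wt≥0 (NonPos-resp (act-e-linked link) tws≤0)))
      ... | inj₂ ws≤0 with descent s ws≤0
      ...   | u , u<w , w≗us with descent-< u u<w t (NonPos-resp (act-e-linked-descent link u w≗us) tws≤0)
      ...     | u′ , u′<u , u≗u′t = t ∷ s ∷ u′ , s≤s (ℕ.≤-trans (s≤s u′<u) u<w) , λ c x → begin
        act w (reflect t c) x                                  ≡⟨ w≗us (reflect t c) x ⟩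
        act u (reflect s (reflect t c)) x                      ≡⟨ u≗u′t (reflect s (reflect t c)) x ⟩
        act u′ (reflect t (reflect s (reflect t c))) x         ≡⟨ act-cong u′ (λ y → sym (reflect-braid link (⟨e⟩-flip link) c y)) x ⟩
        act u′ (reflect s (reflect t (reflect s c))) x         ∎
        where open ≡-Reasoning

    signs×descent : ∀ w → Signs w × Descent w
    signs×descent = WF.All.wfRec (On.wellFounded length <-wellFounded) _
                      (λ w → Signs w × Descent w) step
      where
      step : ∀ w → WfRec (_<_ on length) (λ w → Signs w × Descent w) w → Signs w × Descent w
      step []      _  = signs-[] , descent-[]
      step (t ∷ w) ih = Step.signs-∷ t w ih′ , Step.descent-∷ t w ih′
        where
        ih′ : ∀ u → length u ≤ length w → Signs u × Descent u
        ih′ u u≤w = ih {u} (s≤s u≤w)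

    Root : Coeffs → Set
    Root c = Σ[ w ∈ List I ] Σ[ s ∈ I ] c ≗ act w (e s)

    Root-reflect : ∀ t {c} → Root c → Root (reflect t c)
    Root-reflect t (w , s , c≗ws) =
      w ∷ʳ t , s , λ x → trans (reflect-cong t c≗ws x) (sym (cong (λ f → f x) (act-∷ʳ w t (e s))))

    Root-signed : ∀ {c} → Root c → Signed c
    Root-signed (w , s , c≗ws) = Signed-resp (λ x → sym (c≗ws x)) (proj₁ (signs×descent w) s)

    Root-nonNeg : ∀ {c} s → Root c → 0ℤ ℤ.< c s → NonNeg c
    Root-nonNeg s root 0<cs with Root-signed root
    ... | inj₁ c≥0 = c≥0
    ... | inj₂ c≤0 = ⊥-elim (ℤ.<⇒≱ 0<cs (c≤0 s))


⟦_⟧ : Bool → ℤ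
⟦ b ⟧ = if b then 1ℤ else 0ℤ

if-else-0 : ∀ b x → (if b then x else 0ℤ) ≡ x * ⟦ b ⟧
if-else-0 true  x = sym (ℤ.*-identityʳ x)
if-else-0 false x = sym (ℤ.*-zeroʳ x)

⟦yes⟧ : ∀ {P : Set} (d : Dec P) → P → ⟦ does d ⟧ ≡ 1ℤ
⟦yes⟧ d p = cong ⟦_⟧ (dec-true d p)

⟦no⟧ : ∀ {P : Set} (d : Dec P) → ¬ P → ⟦ does d ⟧ ≡ 0ℤ
⟦no⟧ d ¬p = cong ⟦_⟧ (dec-false d ¬p)

∑-linear : ∀ {n} (f g : Fin n → ℤ) a → ∑[ l < n ] (f l - a * g l) ≡ ∑[ l < n ] f l - a * ∑[ l < n ] g l
∑-linear {zero}  f g a = sym (cong (λ z → 0ℤ - z) (ℤ.*-zeroʳ a))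
∑-linear {suc n} f g a rewrite ∑-linear (f ∘ suc) (g ∘ suc) a =
  identity (f zero) (g zero) (∑[ l < n ] f (suc l)) (∑[ l < n ] g (suc l)) a
  where
  identity : ∀ x y u v a → x - a * y + (u - a * v) ≡ x + u - a * (y + v)
  identity = solve-∀

∑-linear-weighted : ∀ {n} (f g w : Fin n → ℤ) a →
  ∑[ l < n ] ((f l - a * g l) * w l) ≡ ∑[ l < n ] (f l * w l) - a * ∑[ l < n ] (g l * w l)
∑-linear-weighted f g w a =
  trans (sum-cong-≗ (λ l → distrib (f l) (g l) a (w l))) (∑-linear (λ l → f l * w l) (λ l → g l * w l) a)
  where
  distrib : ∀ x y a r → (x - a * y) * r ≡ x * r - a * (y * r)
  distrib = solve-∀

∑-sub : ∀ {n} (f g : Fin n → ℤ) → ∑[ l < n ] (f l - g l) ≡ ∑[ l < n ] f l - ∑[ l < n ] g l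
∑-sub f g = trans (sum-cong-≗ (λ l → x-y≡x-1y (f l) (g l)))
                  (trans (∑-linear f g 1ℤ) (sym (x-y≡x-1y (∑[ l < _ ] f l) (∑[ l < _ ] g l))))
  where
  x-y≡x-1y : ∀ x y → x - y ≡ x - 1ℤ * y
  x-y≡x-1y = solve-∀

δ : ∀ {n} → Fin n → Fin n → ℤ
δ = RootSystem.e Fin._≟_

δ-diagonal : ∀ {n} (p : Fin n) → δ p p ≡ 1ℤ
δ-diagonal = RootSystem.e-diagonal Fin._≟_

δ-off : ∀ {n} {p l : Fin n} → p ≢ l → δ p l ≡ 0ℤ
δ-off {p = p} {l} p≢l rewrite dec-false (p Fin.≟ l) p≢l = refl

δ-≡ : ∀ {n} {p l : Fin n} → p ≡ l → δ p l ≡ 1ℤ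
δ-≡ {p = p} refl = δ-diagonal p

δ-sym : ∀ {n} (p l : Fin n) → δ p l ≡ δ l p
δ-sym p l with p Fin.≟ l
... | yes refl = sym (δ-diagonal p)
... | no p≢l   = sym (δ-off (p≢l ∘ sym))

∑-δ : ∀ {n} (p : Fin n) (f : Fin n → ℤ) → ∑[ l < n ] (δ p l * f l) ≡ f p
∑-δ {suc n} zero f = trans (cong₂ _+_ (ℤ.*-identityˡ (f zero))
                             (trans (sum-cong-≗ (λ l → ℤ.*-zeroˡ (f (suc l)))) (sum-replicate-zero n)))
                      (ℤ.+-identityʳ (f zero))
∑-δ (suc p) f = trans (ℤ.+-identityˡ _) (∑-δ p (f ∘ suc))

∑-δ′ : ∀ {n} (p : Fin n) → ∑[ l < n ] δ p l ≡ 1ℤ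
∑-δ′ p = trans (sum-cong-≗ (λ l → sym (ℤ.*-identityʳ (δ p l)))) (∑-δ p (λ _ → 1ℤ))

sumAll-β : ∀ {n} k → k ≤ n → sumAll {n} (β k) ≡ + k
sumAll-β {n}     zero    _         = sum-replicate-zero n
sumAll-β {suc n} (suc k) (s≤s k≤n) = cong (λ z → 1ℤ + z) (sumAll-β k k≤n)

inject₁≢suc : ∀ {n} (i j : Fin n) → toℕ i ≢ suc (toℕ j) → inject₁ i ≢ suc j
inject₁≢suc i j i≢1+j eq = i≢1+j (trans (sym (Fin.toℕ-inject₁ i)) (cong toℕ eq))

adjacent : ∀ {n} (i j : Fin (suc n)) → toℕ j ≡ suc (toℕ i) → Σ[ l ∈ Fin n ] inject₁ l ≡ i × suc l ≡ j
adjacent i (suc l) 1+l≡1+i = l , Fin.toℕ-injective (trans (Fin.toℕ-inject₁ l) (ℕ.suc-injective 1+l≡1+i)) , refl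

transpose-≡ˡ : ∀ {n} (i j : Fin n) → transpose i j i ≡ j
transpose-≡ˡ i j rewrite dec-true (i Fin.≟ i) refl = refl

transpose-≡ʳ : ∀ {n} (i j : Fin n) → i ≢ j → transpose i j j ≡ i
transpose-≡ʳ i j i≢j rewrite dec-false (j Fin.≟ i) (i≢j ∘ sym) | dec-true (j Fin.≟ j) refl = refl

if-+ : ∀ b x y → (if b then x + y else x) ≡ x + ⟦ b ⟧ * y
if-+ true  x y = cong (λ z → x + z) (sym (ℤ.*-identityˡ y))
if-+ false x y = sym (trans (cong (λ z → x + z) (ℤ.*-zeroˡ y)) (ℤ.+-identityʳ x))

-- Abstracting over l ≟ i and l ≟ j also decides the transposition hidden in sSwap.
sSwap-reflection : ∀ {n} {i j : Fin n} → i ≢ j → ∀ x l → sSwap i j x l ≡ x l - (x j - x i) * (δ j l - δ i l)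
sSwap-reflection {i = i} {j} i≢j x l with l Fin.≟ i
... | yes refl =
  trans (at-i (x i) (x j)) (cong (λ z → x i - (x j - x i) * z) (sym (cong₂ _-_ (δ-off (i≢j ∘ sym)) (δ-diagonal i))))
  where
  at-i : ∀ a b → b ≡ a - (b - a) * (0ℤ - 1ℤ)
  at-i = solve-∀
... | no l≢i with l Fin.≟ j
...   | yes refl =
  trans (at-j (x i) (x l)) (cong (λ z → x l - (x l - x i) * z) (sym (cong₂ _-_ (δ-diagonal l) (δ-off i≢j))))
  where
  at-j : ∀ a b → a ≡ b - (b - a) * (1ℤ - 0ℤ)
  at-j = solve-∀
...   | no l≢j =
  trans (elsewhere (x l) (x j - x i)) (cong (λ z → x l - (x j - x i) * z) (sym (cong₂ _-_ (δ-off (l≢j ∘ sym)) (δ-off (l≢i ∘ sym)))))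
  where
  elsewhere : ∀ a b → a ≡ a - b * (0ℤ - 0ℤ)
  elsewhere = solve-∀

i*n/n≡i : ∀ i n → i * + suc n ℤ./ + suc n ≡ i
i*n/n≡i i n = sym (ℤ.i-j≡0⇒i≡j i q (small-multiple-zero (i - q) (rearrange i q (+ r) (+ suc n) division)))
  where
  q : ℤ
  q = i * + suc n ℤ./ + suc n
  r : ℕ
  r = i * + suc n ℤ.% + suc n
  division : i * + suc n ≡ + r + q * + suc n
  division = a≡a%n+[a/n]*n (i * + suc n) (+ suc n)
  rearrange : ∀ i q r d → i * d ≡ r + q * d → (i - q) * d ≡ r
  rearrange i q r d eq = trans (identity₁ i q d) (trans (cong (_- q * d) eq) (identity₂ r q d))
    where
    identity₁ : ∀ i q d → (i - q) * d ≡ i * d - q * d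
    identity₁ = solve-∀
    identity₂ : ∀ r q d → r + q * d - q * d ≡ r
    identity₂ = solve-∀
  small-multiple-zero : ∀ t → t * + suc n ≡ + r → t ≡ 0ℤ
  small-multiple-zero (+ zero)  _  = refl
  small-multiple-zero (+ suc t) eq = ⊥-elim (ℕ.<⇒≱ (n%d<d (i * + suc n) (+ suc n))
                                       (ℕ.≤-trans (ℕ.m≤m+n (suc n) (t ℕ.* suc n)) (ℕ.≤-reflexive (ℤ.+-injective eq))))
  small-multiple-zero -[1+ t ] ()

deg-exact : ∀ {n} k (x : Vec n) a → 1 ≤ k → sumAll x ≡ a * + k → deg k x ≡ a
deg-exact (suc k) x a _ sum≡ak = trans (cong (ℤ._/ + suc k) sum≡ak) (i*n/n≡i a k)

-- J_{k,n} with n = m + 1.  Simple roots are indexed by Fin n: zero is β and suc j is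
-- α_{j+1} = e_{j+2} - e_{j+1}.
module JRootSystem (k m : ℕ) where

  open RootSystem (Fin._≟_ {suc m}) public

  simpleRoot : Fin (suc m) → Vec (suc m)
  simpleRoot zero    = β k
  simpleRoot (suc j) l = δ (suc j) l - δ (inject₁ j) l

  coords : Coeffs → Vec (suc m)
  coords c l = ∑[ s < suc m ] (c s * simpleRoot s l)

  coords-cong : ∀ {c d} → c ≗ d → coords c ≗ coords d
  coords-cong c≗d l = sum-cong-≗ (λ s → cong (_* simpleRoot s l) (c≗d s))

  coords-linear : ∀ c d a l → coords (λ s → c s - a * d s) l ≡ coords c l - a * coords d l
  coords-linear c d a l = ∑-linear-weighted c d (λ s → simpleRoot s l) a

  coords-e : ∀ t → coords (e t) ≗ simpleRoot t
  coords-e t l = ∑-δ t (λ s → simpleRoot s l)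

  ⟦k≤_⟧ : ℕ → ℤ
  ⟦k≤ a ⟧ = ⟦ does (k ℕ.≤? a) ⟧

  β-complement : ∀ (l : Fin (suc m)) → β k l ≡ 1ℤ - ⟦k≤ toℕ l ⟧
  β-complement l = go (k ℕ.≤? toℕ l)
    where
    go : Dec (k ≤ toℕ l) → β k l ≡ 1ℤ - ⟦k≤ toℕ l ⟧
    go (yes k≤l) = trans (⟦no⟧ (suc (toℕ l) ℕ.≤? k) (ℕ.≤⇒≯ k≤l))
                         (cong (λ z → 1ℤ - z) (sym (⟦yes⟧ (k ℕ.≤? toℕ l) k≤l)))
    go (no k≰l)  = trans (⟦yes⟧ (suc (toℕ l) ℕ.≤? k) (ℕ.≰⇒> k≰l))
                         (cong (λ z → 1ℤ - z) (sym (⟦no⟧ (k ℕ.≤? toℕ l) k≰l)))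

  sumFrom-∑ : ∀ x → sumFrom k x ≡ ∑[ l < suc m ] (x l * ⟦k≤ toℕ l ⟧)
  sumFrom-∑ x = sum-cong-≗ (λ l → if-else-0 (does (k ℕ.≤? toℕ l)) (x l))

  sumFrom-linear : ∀ x y a → sumFrom k (λ l → x l - a * y l) ≡ sumFrom k x - a * sumFrom k y
  sumFrom-linear x y a =
    trans (sumFrom-∑ (λ l → x l - a * y l))
          (trans (∑-linear-weighted x y (λ l → ⟦k≤ toℕ l ⟧) a)
                 (sym (cong₂ (λ u v → u - a * v) (sumFrom-∑ x) (sumFrom-∑ y))))

  sumFrom-cong : ∀ {x y : Vec (suc m)} → x ≗ y → sumFrom k x ≡ sumFrom k y
  sumFrom-cong x≗y = sum-cong-≗ (λ l → cong (λ z → if does (k ℕ.≤? toℕ l) then z else 0ℤ) (x≗y l))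

  sumFrom-δ : ∀ p → sumFrom k (δ p) ≡ ⟦k≤ toℕ p ⟧
  sumFrom-δ p = trans (sumFrom-∑ (δ p)) (∑-δ p (λ l → ⟦k≤ toℕ l ⟧))

  sumFrom-β : sumFrom k (β {suc m} k) ≡ 0ℤ
  sumFrom-β = begin
    sumFrom k (β {suc m} k)                         ≡⟨ sumFrom-∑ (β {suc m} k) ⟩
    ∑[ l < suc m ] (β k l * ⟦k≤ toℕ l ⟧)            ≡⟨ sum-cong-≗ (λ l → trans (cong (_* ⟦k≤ toℕ l ⟧) (β-complement l))
                                                                             (complement-disjoint (does (k ℕ.≤? toℕ l)))) ⟩
    ∑[ l < suc m ] 0ℤ                             ≡⟨ sum-replicate-zero (suc m) ⟩
    0ℤ                                            ∎
    where
    open ≡-Reasoning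
    complement-disjoint : ∀ b → (1ℤ - ⟦ b ⟧) * ⟦ b ⟧ ≡ 0ℤ
    complement-disjoint true  = refl
    complement-disjoint false = refl

  -- The simple coroots, read off in coordinates, so that reflect zero is s_β and reflect (suc j)
  -- swaps the coordinates j and j + 1 (sβ-coords and sSwap-coords).
  ⟨_,_⟩ : Coeffs → Fin (suc m) → ℤ
  ⟨ c , zero ⟩  = + 2 * c zero - sumFrom k (coords c)
  ⟨ c , suc j ⟩ = coords c (suc j) - coords c (inject₁ j)

  ⟨⟩-cong : ∀ {c d} → c ≗ d → ∀ s → ⟨ c , s ⟩ ≡ ⟨ d , s ⟩
  ⟨⟩-cong c≗d zero    = cong₂ (λ x y → + 2 * x - y) (c≗d zero) (sumFrom-cong (coords-cong c≗d))
  ⟨⟩-cong c≗d (suc j) = cong₂ _-_ (coords-cong c≗d (suc j)) (coords-cong c≗d (inject₁ j))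

  ⟨⟩-linear : ∀ c d a s → ⟨ (λ t → c t - a * d t) , s ⟩ ≡ ⟨ c , s ⟩ - a * ⟨ d , s ⟩
  ⟨⟩-linear c d a zero =
    trans (cong (λ z → + 2 * (c zero - a * d zero) - z)
                (trans (sumFrom-cong (coords-linear c d a)) (sumFrom-linear (coords c) (coords d) a)))
          (identity (c zero) (d zero) (sumFrom k (coords c)) (sumFrom k (coords d)) a)
    where
    identity : ∀ x y u v a → + 2 * (x - a * y) - (u - a * v) ≡ + 2 * x - u - a * (+ 2 * y - v)
    identity = solve-∀
  ⟨⟩-linear c d a (suc j) =
    trans (cong₂ _-_ (coords-linear c d a (suc j)) (coords-linear c d a (inject₁ j)))
          (identity (coords c (suc j)) (coords d (suc j)) (coords c (inject₁ j)) (coords d (inject₁ j)) a)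
    where
    identity : ∀ x y u v a → x - a * y - (u - a * v) ≡ x - u - a * (y - v)
    identity = solve-∀

  βα-entry : ℕ → ℤ
  βα-entry a = ⟦k≤ a ⟧ - ⟦k≤ suc a ⟧

  βα-entry-values : ∀ a → βα-entry a ≡ -1ℤ ⊎ βα-entry a ≡ 0ℤ
  βα-entry-values a = go (k ℕ.≤? a) (k ℕ.≤? suc a)
    where
    go : Dec (k ≤ a) → Dec (k ≤ suc a) → βα-entry a ≡ -1ℤ ⊎ βα-entry a ≡ 0ℤ
    go (yes k≤a) _ =
      inj₂ (cong₂ _-_ (⟦yes⟧ (k ℕ.≤? a) k≤a) (⟦yes⟧ (k ℕ.≤? suc a) (ℕ.m≤n⇒m≤1+n k≤a)))
    go (no k≰a) (yes k≤1+a) = inj₁ (cong₂ _-_ (⟦no⟧ (k ℕ.≤? a) k≰a) (⟦yes⟧ (k ℕ.≤? suc a) k≤1+a))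
    go (no k≰a) (no k≰1+a)  = inj₂ (cong₂ _-_ (⟦no⟧ (k ℕ.≤? a) k≰a) (⟦no⟧ (k ℕ.≤? suc a) k≰1+a))

  sumFrom-α : ∀ j → sumFrom k (simpleRoot (suc j)) ≡ ⟦k≤ suc (toℕ j) ⟧ - ⟦k≤ toℕ j ⟧
  sumFrom-α j = begin
    sumFrom k (simpleRoot (suc j))
      ≡⟨ sumFrom-∑ (simpleRoot (suc j)) ⟩
    ∑[ l < suc m ] ((δ (suc j) l - δ (inject₁ j) l) * ⟦k≤ toℕ l ⟧)
      ≡⟨ sum-cong-≗ (λ l → distrib (δ (suc j) l) (δ (inject₁ j) l) ⟦k≤ toℕ l ⟧) ⟩
    ∑[ l < suc m ] (δ (suc j) l * ⟦k≤ toℕ l ⟧ - δ (inject₁ j) l * ⟦k≤ toℕ l ⟧)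
      ≡⟨ ∑-sub (λ l → δ (suc j) l * ⟦k≤ toℕ l ⟧) (λ l → δ (inject₁ j) l * ⟦k≤ toℕ l ⟧) ⟩
    ∑[ l < suc m ] (δ (suc j) l * ⟦k≤ toℕ l ⟧) - ∑[ l < suc m ] (δ (inject₁ j) l * ⟦k≤ toℕ l ⟧)
      ≡⟨ cong₂ _-_ (∑-δ (suc j) (λ l → ⟦k≤ toℕ l ⟧))
                   (trans (∑-δ (inject₁ j) (λ l → ⟦k≤ toℕ l ⟧)) (cong ⟦k≤_⟧ (Fin.toℕ-inject₁ j))) ⟩
    ⟦k≤ suc (toℕ j) ⟧ - ⟦k≤ toℕ j ⟧
      ∎
    where
    open ≡-Reasoning
    distrib : ∀ x y w → (x - y) * w ≡ x * w - y * w
    distrib = solve-∀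

  ⟨e⟩-β-α : ∀ j → ⟨ e zero , suc j ⟩ ≡ βα-entry (toℕ j)
  ⟨e⟩-β-α j = begin
    coords (e zero) (suc j) - coords (e zero) (inject₁ j)
      ≡⟨ cong₂ _-_ (trans (coords-e zero (suc j)) (β-complement (suc j)))
                   (trans (coords-e zero (inject₁ j)) (trans (β-complement (inject₁ j))
                          (cong (λ a → 1ℤ - ⟦k≤ a ⟧) (Fin.toℕ-inject₁ j)))) ⟩
    (1ℤ - ⟦k≤ suc (toℕ j) ⟧) - (1ℤ - ⟦k≤ toℕ j ⟧)
      ≡⟨ identity (⟦k≤ toℕ j ⟧) (⟦k≤ suc (toℕ j) ⟧) ⟩
    βα-entry (toℕ j)
      ∎
    where
    open ≡-Reasoning
    identity : ∀ x y → (1ℤ - y) - (1ℤ - x) ≡ x - y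
    identity = solve-∀

  ⟨e⟩-α-β : ∀ j → ⟨ e (suc j) , zero ⟩ ≡ βα-entry (toℕ j)
  ⟨e⟩-α-β j =
    trans (cong (λ z → + 2 * 0ℤ - z) (trans (sumFrom-cong (coords-e (suc j))) (sumFrom-α j)))
          (identity (⟦k≤ toℕ j ⟧) (⟦k≤ suc (toℕ j) ⟧))
    where
    identity : ∀ x y → + 2 * 0ℤ - (y - x) ≡ x - y
    identity = solve-∀

  ⟨e⟩-α-α : ∀ i j → ⟨ e (suc i) , suc j ⟩ ≡
            (δ (suc i) (suc j) - δ (inject₁ i) (suc j)) - (δ (suc i) (inject₁ j) - δ (inject₁ i) (inject₁ j))
  ⟨e⟩-α-α i j = cong₂ _-_ (coords-e (suc i) (suc j)) (coords-e (suc i) (inject₁ j))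

  ⟨e⟩-α-α-off : ∀ {i j} → suc i ≢ suc j → ⟨ e (suc i) , suc j ⟩ ≡ - δ (inject₁ i) (suc j) - δ (suc i) (inject₁ j)
  ⟨e⟩-α-α-off {i} {j} i≢j =
    trans (⟨e⟩-α-α i j)
          (trans (cong₂ (λ a d → (a - δ (inject₁ i) (suc j)) - (δ (suc i) (inject₁ j) - d))
                        (δ-off i≢j) (δ-off (i≢j ∘ cong suc ∘ Fin.inject₁-injective)))
                 (identity (δ (inject₁ i) (suc j)) (δ (suc i) (inject₁ j))))
    where
    identity : ∀ b c → (0ℤ - b) - (c - 0ℤ) ≡ - b - c
    identity = solve-∀

  ⟨⟩-diagonal : ∀ s → ⟨ e s , s ⟩ ≡ + 2
  ⟨⟩-diagonal zero    = cong (λ z → + 2 * 1ℤ - z) (trans (sumFrom-cong (coords-e zero)) sumFrom-β)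
  ⟨⟩-diagonal (suc j) = trans (⟨e⟩-α-α j j)
    (cong₂ _-_ (cong₂ _-_ (δ-diagonal (suc j)) (δ-off (inject₁≢suc j j (ℕ.1+n≢n ∘ sym))))
               (cong₂ _-_ (δ-off (inject₁≢suc j j (ℕ.1+n≢n ∘ sym) ∘ sym)) (δ-diagonal (inject₁ j))))

  ⟨⟩-symmetric : ∀ s t → ⟨ e s , t ⟩ ≡ ⟨ e t , s ⟩
  ⟨⟩-symmetric zero    zero    = refl
  ⟨⟩-symmetric zero    (suc j) = trans (⟨e⟩-β-α j) (sym (⟨e⟩-α-β j))
  ⟨⟩-symmetric (suc i) zero    = trans (⟨e⟩-α-β i) (sym (⟨e⟩-β-α i))
  ⟨⟩-symmetric (suc i) (suc j) = begin
    ⟨ e (suc i) , suc j ⟩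
      ≡⟨ ⟨e⟩-α-α i j ⟩
    (δ (suc i) (suc j) - δ (inject₁ i) (suc j)) - (δ (suc i) (inject₁ j) - δ (inject₁ i) (inject₁ j))
      ≡⟨ identity (δ (suc i) (suc j)) (δ (inject₁ i) (suc j)) (δ (suc i) (inject₁ j)) (δ (inject₁ i) (inject₁ j)) ⟩
    (δ (suc i) (suc j) - δ (suc i) (inject₁ j)) - (δ (inject₁ i) (suc j) - δ (inject₁ i) (inject₁ j))
      ≡⟨ cong₂ _-_ (cong₂ _-_ (δ-sym (suc i) (suc j)) (δ-sym (suc i) (inject₁ j)))
                   (cong₂ _-_ (δ-sym (inject₁ i) (suc j)) (δ-sym (inject₁ i) (inject₁ j))) ⟩
    (δ (suc j) (suc i) - δ (inject₁ j) (suc i)) - (δ (suc j) (inject₁ i) - δ (inject₁ j) (inject₁ i))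
      ≡⟨ sym (⟨e⟩-α-α j i) ⟩
    ⟨ e (suc j) , suc i ⟩
      ∎
    where
    open ≡-Reasoning
    identity : ∀ a b c d → (a - b) - (c - d) ≡ (a - c) - (b - d)
    identity = solve-∀

  ⟨⟩-offDiagonal : ∀ s t → s ≢ t → ⟨ e s , t ⟩ ≡ -1ℤ ⊎ ⟨ e s , t ⟩ ≡ 0ℤ
  ⟨⟩-offDiagonal zero    zero    0≢0 = ⊥-elim (0≢0 refl)
  ⟨⟩-offDiagonal zero    (suc j) _   = Sum.map (trans (⟨e⟩-β-α j)) (trans (⟨e⟩-β-α j)) (βα-entry-values (toℕ j))
  ⟨⟩-offDiagonal (suc j) zero    _   = Sum.map (trans (⟨e⟩-α-β j)) (trans (⟨e⟩-α-β j)) (βα-entry-values (toℕ j))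
  ⟨⟩-offDiagonal (suc i) (suc j) i≢j with inject₁ i Fin.≟ suc j | suc i Fin.≟ inject₁ j
  ... | yes i=j+1 | yes i+1=j = ⊥-elim (ℕ.m≢1+n+m (toℕ j) {1} (begin
    toℕ j                  ≡⟨ sym (trans (cong toℕ i+1=j) (Fin.toℕ-inject₁ j)) ⟩
    suc (toℕ i)            ≡⟨ cong suc (trans (sym (Fin.toℕ-inject₁ i)) (cong toℕ i=j+1)) ⟩
    suc (suc (toℕ j))      ∎))
    where open ≡-Reasoning
  ... | yes i=j+1 | no  i+1≢j = inj₁ (trans (⟨e⟩-α-α-off i≢j) (cong₂ (λ x y → - x - y) (δ-≡ i=j+1) (δ-off i+1≢j)))
  ... | no  i≢j+1 | yes i+1=j = inj₁ (trans (⟨e⟩-α-α-off i≢j) (cong₂ (λ x y → - x - y) (δ-off i≢j+1) (δ-≡ i+1=j)))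
  ... | no  i≢j+1 | no  i+1≢j = inj₂ (trans (⟨e⟩-α-α-off i≢j) (cong₂ (λ x y → - x - y) (δ-off i≢j+1) (δ-off i+1≢j)))

  open SimplyLaced ⟨_,_⟩ ⟨⟩-cong ⟨⟩-linear ⟨⟩-diagonal ⟨⟩-symmetric ⟨⟩-offDiagonal public

  sumAll-α : ∀ j → sumAll (simpleRoot (suc j)) ≡ 0ℤ
  sumAll-α j = trans (∑-sub (δ (suc j)) (δ (inject₁ j))) (cong₂ _-_ (∑-δ′ (suc j)) (∑-δ′ (inject₁ j)))

  sumAll-coords : k ≤ suc m → ∀ c → sumAll (coords c) ≡ c zero * + k
  sumAll-coords k≤n c = begin
    ∑[ l < suc m ] ∑[ s < suc m ] (c s * simpleRoot s l)
      ≡⟨ ∑-comm (λ l s → c s * simpleRoot s l) ⟩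
    ∑[ s < suc m ] ∑[ l < suc m ] (c s * simpleRoot s l)
      ≡⟨ sum-cong-≗ (λ s → sym (*-distribˡ-sum (c s) (simpleRoot s))) ⟩
    ∑[ s < suc m ] (c s * sumAll (simpleRoot s))
      ≡⟨ cong₂ _+_ (cong (c zero *_) (sumAll-β k k≤n))
                   (trans (sum-cong-≗ (λ j → trans (cong (c (suc j) *_) (sumAll-α j)) (ℤ.*-zeroʳ (c (suc j)))))
                          (sum-replicate-zero m)) ⟩
    c zero * + k + 0ℤ
      ≡⟨ ℤ.+-identityʳ _ ⟩
    c zero * + k
      ∎
    where open ≡-Reasoning

  deg-coords : 1 ≤ k → k ≤ suc m → ∀ {x} c → x ≗ coords c → deg k x ≡ c zero
  deg-coords 1≤k k≤n c x≗c = deg-exact k _ (c zero) 1≤k (trans (sum-cong-≗ x≗c) (sumAll-coords k≤n c))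

  coords-reflect : ∀ s c l → coords (reflect s c) l ≡ coords c l - ⟨ c , s ⟩ * simpleRoot s l
  coords-reflect s c l =
    trans (coords-linear c (e s) ⟨ c , s ⟩ l) (cong (λ z → coords c l - ⟨ c , s ⟩ * z) (coords-e s l))

  sSwap-coords : ∀ j {x} c → x ≗ coords c → sSwap (inject₁ j) (suc j) x ≗ coords (reflect (suc j) c)
  sSwap-coords j c x≗c l =
    trans (x≗c _) (trans (sSwap-reflection (inject₁≢suc j j (ℕ.1+n≢n ∘ sym)) (coords c) l)
                         (sym (coords-reflect (suc j) c l)))

  sβ-coords : 1 ≤ k → k ≤ suc m → ∀ {x} c → x ≗ coords c → sβ k x ≗ coords (reflect zero c)
  sβ-coords 1≤k k≤n {x} c x≗c l = begin
    sβ k x l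
      ≡⟨ if-+ (does (suc (toℕ l) ℕ.≤? k)) (x l) (sumFrom k x - + 2 * deg k x) ⟩
    x l + β k l * (sumFrom k x - + 2 * deg k x)
      ≡⟨ cong₂ (λ a b → a + β k l * b) (x≗c l)
               (cong₂ (λ a b → a - + 2 * b) (sumFrom-cong x≗c) (deg-coords 1≤k k≤n c x≗c)) ⟩
    coords c l + β k l * (sumFrom k (coords c) - + 2 * c zero)
      ≡⟨ identity (coords c l) (β k l) (sumFrom k (coords c)) (c zero) ⟩
    coords c l - (+ 2 * c zero - sumFrom k (coords c)) * β k l
      ≡⟨ sym (coords-reflect zero c l) ⟩
    coords (reflect zero c) l
      ∎
    where
    open ≡-Reasoning
    identity : ∀ x b u c₀ → x + b * (u - + 2 * c₀) ≡ x - (+ 2 * c₀ - u) * b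
    identity = solve-∀

  realRoot-coords : 1 ≤ k → k ≤ suc m → ∀ {x} → RealRoot k x → Σ[ c ∈ Coeffs ] Root c × x ≗ coords c
  realRoot-coords _ _ root-β = e zero , ([] , zero , λ _ → refl) , λ l → sym (coords-e zero l)
  realRoot-coords 1≤k k≤n (root-si i j j≡1+i rr) with realRoot-coords 1≤k k≤n rr | adjacent i j j≡1+i
  ... | c , root , x≗c | l , refl , refl = reflect (suc l) c , Root-reflect (suc l) root , sSwap-coords l c x≗c
  realRoot-coords 1≤k k≤n (root-sβ rr) with realRoot-coords 1≤k k≤n rr
  ... | c , root , x≗c = reflect zero c , Root-reflect zero root , sβ-coords 1≤k k≤n c x≗c

  reflect-α-zero : ∀ j c → reflect (suc j) c zero ≡ c zero
  reflect-α-zero j c = trans (cong (λ z → c zero - z) (ℤ.*-zeroʳ ⟨ c , suc j ⟩)) (ℤ.+-identityʳ (c zero))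

  reflect-α-suc : ∀ j c → coords (reflect (suc j) c) (suc j) ≡ coords c (inject₁ j)
  reflect-α-suc j c =
    trans (sym (sSwap-coords j c (λ _ → refl) (suc j)))
          (cong (coords c) (transpose-≡ʳ (inject₁ j) (suc j) (inject₁≢suc j j (ℕ.1+n≢n ∘ sym))))

  reflect-α-inject₁ : ∀ j c → coords (reflect (suc j) c) (inject₁ j) ≡ coords c (suc j)
  reflect-α-inject₁ j c =
    trans (sym (sSwap-coords j c (λ _ → refl) (inject₁ j))) (cong (coords c) (transpose-≡ˡ (inject₁ j) (suc j)))

  Moved : Coeffs → Fin (suc m) → Fin (suc m) → Set
  Moved c p l = Σ[ c′ ∈ Coeffs ] Root c′ × c′ zero ≡ c zero × coords c′ p ≡ coords c l

  move-to-last : ∀ l {c} → Root c → Moved c (fromℕ m) l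
  move-to-last = >-weakInduction (λ l → ∀ {c} → Root c → Moved c (fromℕ m) l)
    (λ {c} root → c , root , refl , refl)
    (λ j moved {c} root → case moved (Root-reflect (suc j) root) of λ where
      (c′ , root′ , c′₀ , c′ₘ) → c′ , root′ , trans c′₀ (reflect-α-zero j c) , trans c′ₘ (reflect-α-suc j c))

  move-to-first : ∀ l {c} → Root c → Moved c zero l
  move-to-first = <-weakInduction (λ l → ∀ {c} → Root c → Moved c zero l)
    (λ {c} root → c , root , refl , refl)
    (λ j moved {c} root → case moved (Root-reflect (suc j) root) of λ where
      (c′ , root′ , c′₀ , c′₀′) → c′ , root′ , trans c′₀ (reflect-α-zero j c) , trans c′₀′ (reflect-α-inject₁ j c))


-- Here n = m + 2, so that α_1 and α_{n-1} both exist.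
module _ (k m : ℕ) where

  open JRootSystem k (suc m)

  coords-first : 1 ≤ k → ∀ c → coords c zero ≡ c zero - c (suc zero)
  coords-first 1≤k c = begin
    c zero * β {suc (suc m)} k zero + (c (suc zero) * (0ℤ - 1ℤ) + ∑[ j < m ] (c (suc (suc j)) * (0ℤ - 0ℤ)))
      ≡⟨ cong₂ (λ b s → c zero * b + (c (suc zero) * (0ℤ - 1ℤ) + s)) (⟦yes⟧ (1 ℕ.≤? k) 1≤k)
               (trans (sum-cong-≗ (λ j → ℤ.*-zeroʳ (c (suc (suc j))))) (sum-replicate-zero m)) ⟩
    c zero * 1ℤ + (c (suc zero) * (0ℤ - 1ℤ) + 0ℤ)
      ≡⟨ identity (c zero) (c (suc zero)) ⟩
    c zero - c (suc zero)
      ∎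
    where
    open ≡-Reasoning
    identity : ∀ x y → x * 1ℤ + (y * (0ℤ - 1ℤ) + 0ℤ) ≡ x - y
    identity = solve-∀

  coords-last : k ≤ suc m → ∀ c → coords c (fromℕ (suc m)) ≡ c (fromℕ (suc m))
  coords-last k≤m+1 c = begin
    c zero * β k (suc (fromℕ m)) + ∑[ j < suc m ] (c (suc j) * (δ j (fromℕ m) - δ (inject₁ j) (fromℕ (suc m))))
      ≡⟨ cong₂ (λ b s → c zero * b + s) (⟦no⟧ (suc (suc (toℕ (fromℕ m))) ℕ.≤? k) last∉β)
               (sum-cong-≗ (λ j → cong₂ (λ d d′ → c (suc j) * (d - d′)) (δ-sym j (fromℕ m))
                                         (δ-off {p = inject₁ j} (Fin.fromℕ≢inject₁ {i = j} ∘ sym)))) ⟩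
    c zero * 0ℤ + ∑[ j < suc m ] (c (suc j) * (δ (fromℕ m) j - 0ℤ))
      ≡⟨ cong₂ _+_ (ℤ.*-zeroʳ (c zero)) (sum-cong-≗ (λ j → identity (c (suc j)) (δ (fromℕ m) j))) ⟩
    0ℤ + ∑[ j < suc m ] (δ (fromℕ m) j * c (suc j))
      ≡⟨ trans (ℤ.+-identityˡ _) (∑-δ (fromℕ m) (c ∘ suc)) ⟩
    c (fromℕ (suc m))
      ∎
    where
    open ≡-Reasoning
    last∉β : ¬ suc (suc (toℕ (fromℕ m))) ≤ k
    last∉β p = ℕ.1+n≰n (ℕ.≤-trans (subst (λ a → suc (suc a) ≤ k) (Fin.toℕ-fromℕ m) p) k≤m+1)
    identity : ∀ x d → x * (d - 0ℤ) ≡ d * x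
    identity = solve-∀

  coords-bounds : 1 ≤ k → k ≤ suc m → ∀ {c} → Root c → 0ℤ ℤ.< c zero →
                  ∀ l → 0ℤ ≤ℤ coords c l × coords c l ≤ℤ c zero
  coords-bounds 1≤k k≤m+1 {c} root 0<c₀ l = lower (move-to-last l root) , upper (move-to-first l root)
    where
    nonNeg : ∀ {c′} → Root c′ → c′ zero ≡ c zero → NonNeg c′
    nonNeg root′ c′₀ = Root-nonNeg zero root′ (subst (0ℤ ℤ.<_) (sym c′₀) 0<c₀)

    lower : Moved c (fromℕ (suc m)) l → 0ℤ ≤ℤ coords c l
    lower (c′ , root′ , c′₀ , c′ₘ) =
      subst (0ℤ ≤ℤ_) (trans (sym (coords-last k≤m+1 c′)) c′ₘ) (nonNeg root′ c′₀ (fromℕ (suc m)))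

    upper : Moved c zero l → coords c l ≤ℤ c zero
    upper (c′ , root′ , c′₀ , c′₀′) =
      subst₂ _≤ℤ_ (trans (sym (coords-first 1≤k c′)) c′₀′) c′₀
            (ℤ.i-j≤i (c′ zero) (c′ (suc zero)) {{ℤ.nonNegative (nonNeg root′ c′₀ (suc zero))}})


lemma2p3 : (k n : ℕ) → 1 ≤ k → k < n → (x : Vec n) → RealRoot k x →
    IsPositive k x → (d : ℤ) → deg k x ≡ d → 1ℤ ≤ℤ d →
    (i : Fin n) → (0ℤ ≤ℤ x i) × (x i ≤ℤ d)
lemma2p3 zero    _             ()  _              _ _  _ _ _      _   _
lemma2p3 (suc k) zero          _   ()             _ _  _ _ _      _   _
lemma2p3 (suc k) (suc zero)    _   (s≤s ())       _ _  _ _ _      _   _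
lemma2p3 k       (suc (suc m)) 1≤k (s≤s k≤1+m) x rr _ d deg≡d 1≤d i
  with JRootSystem.realRoot-coords k (suc m) 1≤k (ℕ.m≤n⇒m≤1+n k≤1+m) rr
... | c , root , x≗c =
  subst₂ (λ a b → 0ℤ ≤ℤ a × a ≤ℤ b) (sym (x≗c i)) c₀≡d (coords-bounds k m 1≤k k≤1+m root 0<c₀ i)
  where
  open JRootSystem k (suc m)
  c₀≡d : c zero ≡ d
  c₀≡d = trans (sym (deg-coords 1≤k (ℕ.m≤n⇒m≤1+n k≤1+m) c x≗c)) deg≡d
  0<c₀ : 0ℤ ℤ.< c zero
  0<c₀ = ℤ.<-≤-trans (ℤ.+<+ (s≤s z≤n)) (subst (1ℤ ≤ℤ_) (sym c₀≡d) 1≤d)
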